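{- Let $G$ be a singleton-partition graph of order $n$ with $\delta(G)=0$. Then: (a) If $n=1$, then $G=K_1$, $L_{\rm SCC}(G)=0$, and the $G$-SC chain is $K_1\to K_1\to K_1\to\cdots$. (b) If $n=2$, then $G=\overline{K}_2$, $L_{\rm SCC}(G)=\infty$, and the $G$-SC chain is $\overline{K}_2\to K_2\to\overline{K}_2\to K_2\to\cdots$. (c) If $n>3$, then $G\cong K_1\cup K_{n-1}$, $L_{\rm SCC}(G)=1$, and the $G$-SC chain is $G\to K_{1,n-1}$. (d) If $n=3$, then $G=K_1\cup K_2$, $L_{\rm SCC}(G)=\infty$, and the $G$-SC chain is $K_1\cup K_2\to P_3\to K_1\cup K_2\to P_3\to\cdots$.
   Context: All graphs are finite and simple. A full vertex is a vertex adjacent to all other vertices. A set $D\subseteq V$ is dominating if every vertex not in $D$ has a neighbor in $D$. Two disjoint sets $A,B\subseteq V$ form a coalition if neither is dominating but $A\cup B$ is. A coalition partition of $G$ is a partition $\mathcal{P}$ of $V$ such that every member is either a dominating set of cardinality 1, or is not dominating and forms a coalition with some other member. The coalition graph ${\rm CG}(G,\mathcal{P})$ has vertex set $\mathcal{P}$, two members adjacent iff they form a coalition. $\Gamma_1$ is the partition of $V$ into singletons; $G$ is a singleton-partition graph (SP-graph) if $\Gamma_1$ is a coalition partition of $G$. A singleton coalition graph chain with initial graph $G_1$ is a sequence $G_1\to G_2\to\cdots$ where each graph having a successor is an SP-graph and its successor is ${\rm CG}(G_i,\Gamma_1)$ (up to isomorphism). The $G$-SC chain is such a chain starting at $G$ of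 maximum possible length (it continues as long as the current graph is an SP-graph; it is infinite if this never fails). Its length $L_{\rm SCC}(G)$ is $k-1$ for a chain $G_1\to\cdots\to G_k$ and $\infty$ for an infinite chain, with the convention that if all graphs in the chain are isomorphic the length is $0$. (E.g. $C_4\to K_4\to\overline{K}_4$ has length 2.) $\overline{K}_m$ is the edgeless graph on $m$ vertices, $\cup$ is disjoint union. -}

module Defs where

open import Data.Nat using (ℕ; zero; suc; _≤_; _<_; _⊓_)
open import Data.Bool using (Bool; true; false; not)
import Data.Bool.Properties as BoolP
open import Data.Fin using (Fin; zero; suc; _≟_)
open import Data.Fin.Properties using (all?; any?)
open import Data.Fin.Subset using (Subset; _∈_; _∩_; _∪_; ⁅_⁆; ∣_∣; Empty; Nonempty)
open import Data.Fin.Subset.Properties using (_∈?_; nonempty?; x∈⁅x⁆; x∈p∩q⁺; ∩-comm; ∪-comm)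
open import Data.Vec using (tabulate; foldr₁)
open import Data.Product using (Σ; ∃; ∃-syntax; _×_; _,_; proj₁; proj₂)
open import Data.Sum using (_⊎_; inj₁; inj₂)
open import Data.Empty using (⊥)
open import Function using (_∘_)
open import Function.Bundles using (Bijection; _⤖_)
open import Relation.Nullary using (¬_; Dec; yes; no; does)
open import Relation.Nullary.Decidable using (_×-dec_; _⊎-dec_; ¬?)
open import Relation.Binary.PropositionalEquality using (_≡_; _≢_; refl; subst)

record Graph (n : ℕ) : Set where
  field
    adj        : Fin n → Fin n → Bool
    adj-sym    : ∀ u v → adj u v ≡ adj v u
    adj-irrefl : ∀ v → adj v v ≡ false
open Graph public

record _≅_ {n m : ℕ} (G : Graph n) (H : Graph m) : Set where
  field
    bij       : Fin n ⤖ Fin m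
    preserves : ∀ u v → adj G u v ≡ adj H (Bijection.to bij u) (Bijection.to bij v)
infix 4 _≅_

degree : ∀ {n} → Graph n → Fin n → ℕ
degree G v = ∣ tabulate (adj G v) ∣

δ : ∀ {m} → Graph (suc m) → ℕ
δ G = foldr₁ _⊓_ (tabulate (degree G))

Dominating : ∀ {n} → Graph n → Subset n → Set
Dominating {n} G D = ∀ (v : Fin n) → v ∈ D ⊎ ∃[ u ] (u ∈ D × adj G u v ≡ true)

Coalition : ∀ {n} → Graph n → Subset n → Subset n → Set
Coalition G A B =
  Empty (A ∩ B) × ¬ Dominating G A × ¬ Dominating G B × Dominating G (A ∪ B)

IsPartition : ∀ {n k} → (Fin k → Subset n) → Set
IsPartition {n} {k} P =
  (∀ i → Nonempty (P i)) × (∀ i j → i ≢ j → Empty (P i ∩ P j)) × (∀ (v : Fin n) → ∃[ i ] v ∈ P i)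

IsCoalitionPartition : ∀ {n k} → Graph n → (Fin k → Subset n) → Set
IsCoalitionPartition {n} {k} G P =
  IsPartition P ×
  (∀ (i : Fin k) → (Dominating G (P i) × ∣ P i ∣ ≡ 1)
                 ⊎ (¬ Dominating G (P i) × ∃[ j ] (j ≢ i × Coalition G (P i) (P j))))

Γ₁ : ∀ n → Fin n → Subset n
Γ₁ n v = ⁅ v ⁆

IsSP : ∀ {n} → Graph n → Set
IsSP {n} G = IsCoalitionPartition G (Γ₁ n)

dominating? : ∀ {n} (G : Graph n) (D : Subset n) → Dec (Dominating G D)
dominating? G D = all? λ v → (v ∈? D) ⊎-dec any? (λ u → (u ∈? D) ×-dec (adj G u v BoolP.≟ true))

coalition? : ∀ {n} (G : Graph n) (A B : Subset n) → Dec (Coalition G A B)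
coalition? G A B = ¬? (nonempty? (A ∩ B)) ×-dec ¬? (dominating? G A)
                   ×-dec ¬? (dominating? G B) ×-dec dominating? G (A ∪ B)

coalition-sym : ∀ {n} (G : Graph n) (A B : Subset n) → Coalition G A B → Coalition G B A
coalition-sym G A B (e , a , b , d) =
  (λ ne → e (subst Nonempty (∩-comm B A) ne)) , b , a , subst (Dominating G) (∪-comm A B) d

private
  does-≡ : ∀ {a b} {A : Set a} {B : Set b} (x : Dec A) (y : Dec B) → (A → B) → (B → A) → does x ≡ does y
  does-≡ (yes _) (yes _) f g = refl
  does-≡ (yes a) (no ¬b) f g with ¬b (f a)
  ... | ()
  does-≡ (no ¬a) (yes b) f g with ¬a (g b)
  ... | ()
  does-≡ (no _) (no _) f g = refl

  coal-irrefl : ∀ {n} (G : Graph n) (v : Fin n) → ¬ Coalition G ⁅ v ⁆ ⁅ v ⁆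
  coal-irrefl G v (e , _) = e (v , x∈p∩q⁺ (x∈⁅x⁆ v , x∈⁅x⁆ v))

  does-no : ∀ {a} {A : Set a} (x : Dec A) → ¬ A → does x ≡ false
  does-no (yes a) ¬a with ¬a a
  ... | ()
  does-no (no _) _ = refl

-- the coalition graph CG(G, Γ₁), with the member {v} identified with v
CG₁ : ∀ {n} → Graph n → Graph n
adj (CG₁ G) u v = does (coalition? G ⁅ u ⁆ ⁅ v ⁆)
adj-sym (CG₁ G) u v = does-≡ (coalition? G ⁅ u ⁆ ⁅ v ⁆) (coalition? G ⁅ v ⁆ ⁅ u ⁆)
  (coalition-sym G _ _) (coalition-sym G _ _)
adj-irrefl (CG₁ G) v = does-no (coalition? G ⁅ v ⁆ ⁅ v ⁆) (coal-irrefl G v)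

Step : ∀ {n} → Graph n → Graph n → Set
Step G H = IsSP G × (CG₁ G ≅ H)

InfChain : ∀ {n} → Graph n → (ℕ → Graph n) → Set
InfChain G g = (g 0 ≅ G) × (∀ i → Step (g i) (g (suc i)))

FinChain : ∀ {n} → Graph n → ℕ → (ℕ → Graph n) → Set
FinChain G k g = (g 0 ≅ G) × (∀ i → i < k → Step (g i) (g (suc i))) × ¬ IsSP (g k)

data Len : Set where
  fin : ℕ → Len
  ∞   : Len

-- L_SCC(G) = ℓ, with the convention that an all-isomorphic chain has length 0
data LSCC {n} (G : Graph n) : Len → Set where
  fin-chain : ∀ {k} (g : ℕ → Graph n) → FinChain G k g →
              ¬ (∀ i → i ≤ k → g i ≅ g 0) → LSCC G (fin k)
  fin-const : ∀ {k} (g : ℕ → Graph n) → FinChain G k g →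
              (∀ i → i ≤ k → g i ≅ g 0) → LSCC G (fin 0)
  inf-chain : (g : ℕ → Graph n) → InfChain G g →
              ¬ (∀ i → g i ≅ g 0) → LSCC G ∞
  inf-const : (g : ℕ → Graph n) → InfChain G g →
              (∀ i → g i ≅ g 0) → LSCC G (fin 0)

K₁ : Graph 1
adj K₁ _ _ = false
adj-sym K₁ _ _ = refl
adj-irrefl K₁ _ = refl

K̄₂ : Graph 2
adj K̄₂ _ _ = false
adj-sym K̄₂ _ _ = refl
adj-irrefl K̄₂ _ = refl

K₂ : Graph 2
adj K₂ u v = not (does (u ≟ v))
adj-sym K₂ zero zero = refl
adj-sym K₂ zero (suc zero) = refl
adj-sym K₂ (suc zero) zero = refl
adj-sym K₂ (suc zero) (suc zero) = refl
adj-irrefl K₂ zero = refl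
adj-irrefl K₂ (suc zero) = refl

private
  ≟-sym : ∀ {m} (i j : Fin m) → does (i ≟ j) ≡ does (j ≟ i)
  ≟-sym i j = does-≡ (i ≟ j) (j ≟ i) (λ { refl → refl }) (λ { refl → refl })

  ≟-refl : ∀ {m} (i : Fin m) → does (i ≟ i) ≡ true
  ≟-refl i with i ≟ i
  ... | yes _ = refl
  ... | no ¬p with ¬p refl
  ... | ()

K₁∪K : (m : ℕ) → Graph (suc m)
adj (K₁∪K m) zero _ = false
adj (K₁∪K m) (suc _) zero = false
adj (K₁∪K m) (suc i) (suc j) = not (does (i ≟ j))
adj-sym (K₁∪K m) zero zero = refl
adj-sym (K₁∪K m) zero (suc _) = refl
adj-sym (K₁∪K m) (suc _) zero = refl
adj-sym (K₁∪K m) (suc i) (suc j) rewrite ≟-sym i j = refl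
adj-irrefl (K₁∪K m) zero = refl
adj-irrefl (K₁∪K m) (suc i) rewrite ≟-refl i = refl

Star : (m : ℕ) → Graph (suc m)
adj (Star m) zero zero = false
adj (Star m) zero (suc _) = true
adj (Star m) (suc _) zero = true
adj (Star m) (suc _) (suc _) = false
adj-sym (Star m) zero zero = refl
adj-sym (Star m) zero (suc _) = refl
adj-sym (Star m) (suc _) zero = refl
adj-sym (Star m) (suc _) (suc _) = refl
adj-irrefl (Star m) zero = refl
adj-irrefl (Star m) (suc _) = refl

K₁∪K₂ : Graph 3
K₁∪K₂ = K₁∪K 2

P₃ : Graph 3
adj P₃ zero (suc zero) = true
adj P₃ (suc zero) zero = true
adj P₃ (suc zero) (suc (suc zero)) = true
adj P₃ (suc (suc zero)) (suc zero) = true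
adj P₃ _ _ = false
adj-sym P₃ zero zero = refl
adj-sym P₃ zero (suc zero) = refl
adj-sym P₃ zero (suc (suc zero)) = refl
adj-sym P₃ (suc zero) zero = refl
adj-sym P₃ (suc zero) (suc zero) = refl
adj-sym P₃ (suc zero) (suc (suc zero)) = refl
adj-sym P₃ (suc (suc zero)) zero = refl
adj-sym P₃ (suc (suc zero)) (suc zero) = refl
adj-sym P₃ (suc (suc zero)) (suc (suc zero)) = refl
adj-irrefl P₃ zero = refl
adj-irrefl P₃ (suc zero) = refl
adj-irrefl P₃ (suc (suc zero)) = refl

alternate : ∀ {n} → Graph n → Graph n → ℕ → Graph n
alternate A B zero = A
alternate A B (suc zero) = B
alternate A B (suc (suc i)) = alternate A B i

-- An isolated vertex v lies in every dominating set. So in an SP-graph no singleton {w} with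
-- w ≠ v dominates, and the partner {j} of {w} must be {v}; then {v, w} dominates, which forces w
-- to be adjacent to every vertex other than v and w. Hence G ≅ K₁ ∪ K_{n-1}, and the chain is
-- computed from this graph: for n ≥ 4 its coalition graph is the star K_{1,n-1}, in which two
-- leaves miss a third leaf and the centre alone dominates, so the chain stops there.
module Submission where

open import Defs
open import Data.Nat using (ℕ; suc; _<_)
open import Data.Product using (_×_; ∃-syntax)
open import Relation.Binary.PropositionalEquality using (_≡_)

open import Data.Nat using (zero; _+_; _⊓_; z≤n; s≤s)
import Data.Nat as ℕ
open import Data.Bool using (Bool; true; false; not; _∧_)
import Data.Bool.Properties as Bool
open import Data.Fin using (Fin; zero; suc; _≟_)
open import Data.Fin.Properties using (all?; any?; suc-injective)
open import Data.Fin.Permutation using (transpose; _⟨$⟩ʳ_)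
open import Data.Fin.Subset using (Subset; _∈_; _∉_; _⊆_; _∪_; _∩_; ⁅_⁆; ∣_∣; Empty)
open import Data.Fin.Subset.Properties
  using (x∈⁅x⁆; x∈⁅y⁆⇒x≡y; p⊆p∪q; x∈p∪q⁺; x∈p∪q⁻; x∈p∩q⁻)
open import Data.Vec using (tabulate; foldr₁)
open import Data.Product using (∃; _,_; proj₁; proj₂)
open import Data.Sum using (_⊎_; inj₁; inj₂)
open import Data.Empty using (⊥-elim)
open import Function using (_∘_)
open import Function.Bundles using (Bijection; _⤖_)
open import Function.Construct.Identity using (⤖-id)
open import Function.Definitions using (Injective)
open import Function.Properties.Inverse using (↔⇒⤖)
open import Relation.Nullary using (¬_; Dec; yes; no; does)
open import Relation.Nullary.Decidable
  using (_×-dec_; _⊎-dec_; ¬?; True; toWitness; dec-true; dec-false)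
open import Relation.Binary.PropositionalEquality
  using (_≢_; refl; sym; trans; cong; subst; module ≡-Reasoning)

private
  variable
    n : ℕ

∈-pair : {x a b : Fin n} → x ∈ ⁅ a ⁆ ∪ ⁅ b ⁆ → x ≡ a ⊎ x ≡ b
∈-pair {a = a} {b} x∈ with x∈p∪q⁻ ⁅ a ⁆ ⁅ b ⁆ x∈
... | inj₁ x∈a = inj₁ (x∈⁅y⁆⇒x≡y a x∈a)
... | inj₂ x∈b = inj₂ (x∈⁅y⁆⇒x≡y b x∈b)

∈-pairˡ : (a b : Fin n) → a ∈ ⁅ a ⁆ ∪ ⁅ b ⁆
∈-pairˡ a b = x∈p∪q⁺ (inj₁ (x∈⁅x⁆ a))

∈-pairʳ : (a b : Fin n) → b ∈ ⁅ a ⁆ ∪ ⁅ b ⁆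
∈-pairʳ a b = x∈p∪q⁺ (inj₂ (x∈⁅x⁆ b))

∉-pair : {x a b : Fin n} → x ≢ a → x ≢ b → x ∉ ⁅ a ⁆ ∪ ⁅ b ⁆
∉-pair x≢a x≢b x∈ with ∈-pair x∈
... | inj₁ x≡a = x≢a x≡a
... | inj₂ x≡b = x≢b x≡b

⁅⁆-disjoint : {a b : Fin n} → a ≢ b → Empty (⁅ a ⁆ ∩ ⁅ b ⁆)
⁅⁆-disjoint {a = a} {b} a≢b (x , x∈) with x∈p∩q⁻ ⁅ a ⁆ ⁅ b ⁆ x∈
... | x∈a , x∈b = a≢b (trans (sym (x∈⁅y⁆⇒x≡y a x∈a)) (x∈⁅y⁆⇒x≡y b x∈b))

∉⁅⁆ : {a b : Fin n} → a ≢ b → a ∉ ⁅ b ⁆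
∉⁅⁆ {b = b} a≢b a∈ = a≢b (x∈⁅y⁆⇒x≡y b a∈)

-- IsSP G unfolds to IsPartition (Γ₁ n) × (∀ i → SingletonMember G i).
SingletonMember : Graph n → Fin n → Set
SingletonMember {n} G i = (Dominating G ⁅ i ⁆ × ∣ ⁅ i ⁆ ∣ ≡ 1)
                        ⊎ (¬ Dominating G ⁅ i ⁆ × ∃[ j ] (j ≢ i × Coalition G ⁅ i ⁆ ⁅ j ⁆))

coalition-¬dominatingˡ : {G : Graph n} {A B : Subset n} → Coalition G A B → ¬ Dominating G A
coalition-¬dominatingˡ (_ , ¬dom-A , _) = ¬dom-A

Γ₁-isPartition : ∀ n → IsPartition (Γ₁ n)
Γ₁-isPartition n = (λ i → i , x∈⁅x⁆ i) , (λ _ _ → ⁅⁆-disjoint) , (λ v → v , x∈⁅x⁆ v)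

≅-refl : {G : Graph n} → G ≅ G
≅-refl = record { bij = ⤖-id _ ; preserves = λ _ _ → refl }

Relabels : ∀ {m} → Graph n → Graph m → (Fin n ⤖ Fin m) → Set
Relabels {n} G H σ = ∀ (u w : Fin n) → adj G u w ≡ adj H (Bijection.to σ u) (Bijection.to σ w)

relabels? : ∀ {m} (G : Graph n) (H : Graph m) (σ : Fin n ⤖ Fin m) → Dec (Relabels G H σ)
relabels? G H σ = all? λ u → all? λ w → adj G u w Bool.≟ adj H (Bijection.to σ u) (Bijection.to σ w)

≅-by-relabelling : ∀ {m} (G : Graph n) (H : Graph m) (σ : Fin n ⤖ Fin m) →
                   {True (relabels? G H σ)} → G ≅ H
≅-by-relabelling G H σ {ok} = record { bij = σ ; preserves = toWitness ok }

true≢false : true ≢ false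
true≢false ()

Isolated : Graph n → Fin n → Set
Isolated {n} G v = ∀ (x : Fin n) → adj G v x ≡ false

Full : Graph n → Fin n → Set
Full {n} G c = ∀ (x : Fin n) → x ≢ c → adj G c x ≡ true

≅-reflects-isolated : ∀ {m} {G : Graph n} {H : Graph m} (i : G ≅ H) {x} →
                      Isolated H (Bijection.to (_≅_.bij i) x) → Isolated G x
≅-reflects-isolated i {x} iso w = trans (_≅_.preserves i x w) (iso _)

full-≇-isolated : ∀ {G H : Graph n} {c y z} → Full G c → y ≢ c → Isolated H z → ¬ G ≅ H
full-≇-isolated {G = G} {H} {c} {y} {z} full y≢c iso i with Bijection.surjective (_≅_.bij i) z
... | x , σx≡z with ≅-reflects-isolated i (subst (Isolated H) (sym (σx≡z refl)) iso) | x ≟ c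
... | x-isolated | yes refl = true≢false (trans (sym (full y y≢c)) (x-isolated y))
... | x-isolated | no x≢c   =
  true≢false (trans (sym (full x x≢c)) (trans (adj-sym G c x) (x-isolated c)))

⊓≡0 : ∀ a b → a ⊓ b ≡ 0 → a ≡ 0 ⊎ b ≡ 0
⊓≡0 zero    b       _  = inj₁ refl
⊓≡0 (suc a) zero    _  = inj₂ refl
⊓≡0 (suc a) (suc b) ()

foldr₁-⊓≡0 : ∀ m (f : Fin (suc m) → ℕ) → foldr₁ _⊓_ (tabulate f) ≡ 0 → ∃ λ i → f i ≡ 0
foldr₁-⊓≡0 zero    f eq = zero , eq
foldr₁-⊓≡0 (suc m) f eq with ⊓≡0 (f zero) _ eq
... | inj₁ f0≡0 = zero , f0≡0
... | inj₂ rest≡0 with foldr₁-⊓≡0 m (f ∘ suc) rest≡0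
... | i , fi≡0 = suc i , fi≡0

∣tabulate∣≡0 : ∀ {n} (f : Fin n → Bool) → ∣ tabulate f ∣ ≡ 0 → ∀ x → f x ≡ false
∣tabulate∣≡0 {suc n} f eq x with f zero in f0
∣tabulate∣≡0 f ()  x       | true
∣tabulate∣≡0 f eq  zero    | false = f0
∣tabulate∣≡0 f eq  (suc x) | false = ∣tabulate∣≡0 (f ∘ suc) eq x

δ≡0⇒isolated : ∀ {m} (G : Graph (suc m)) → δ G ≡ 0 → ∃ (Isolated G)
δ≡0⇒isolated {m} G δ≡0 with foldr₁-⊓≡0 m (degree G) δ≡0
... | v , deg≡0 = v , ∣tabulate∣≡0 (adj G v) deg≡0

Dominating-mono : {G : Graph n} {A B : Subset n} → A ⊆ B → Dominating G A → Dominating G B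
Dominating-mono A⊆B dom v with dom v
... | inj₁ v∈A = inj₁ (A⊆B v∈A)
... | inj₂ (u , u∈A , u~v) = inj₂ (u , A⊆B u∈A , u~v)

isolated-∈-dominating : {G : Graph n} {v : Fin n} {D : Subset n} →
                        Isolated G v → Dominating G D → v ∈ D
isolated-∈-dominating {G = G} {v} iso dom with dom v
... | inj₁ v∈D = v∈D
... | inj₂ (u , _ , u~v) = ⊥-elim (true≢false (trans (sym u~v) (trans (adj-sym G u v) (iso u))))

isolated-not-dominating : {G : Graph n} {v w : Fin n} → Isolated G v → w ≢ v → ¬ Dominating G ⁅ v ⁆
isolated-not-dominating {G = G} {v} {w} iso w≢v dom with dom w
... | inj₁ w∈v = w≢v (x∈⁅y⁆⇒x≡y v w∈v)
... | inj₂ (u , u∈v , u~w) with x∈⁅y⁆⇒x≡y v u∈v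
... | refl = true≢false (trans (sym u~w) (iso w))

record IsK₁∪K (G : Graph n) (a : Fin n) : Set where
  field
    isolated : Isolated G a
    clique   : ∀ {u w} → u ≢ a → w ≢ a → u ≢ w → adj G u w ≡ true
open IsK₁∪K

K₁∪K-adj : Fin n → Fin n → Fin n → Bool
K₁∪K-adj a u w = not (does (u ≟ a)) ∧ not (does (w ≟ a)) ∧ not (does (u ≟ w))

adj-IsK₁∪K : {G : Graph n} {a : Fin n} → IsK₁∪K G a → ∀ u w → adj G u w ≡ K₁∪K-adj a u w
adj-IsK₁∪K {G = G} {a} s u w with u ≟ a | w ≟ a | u ≟ w
... | yes refl | _        | _        = isolated s w
... | no _     | yes refl | _        = trans (adj-sym G u a) (isolated s u)
... | no _     | no _     | yes refl = adj-irrefl G u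
... | no u≢a   | no w≢a   | no u≢w   = clique s u≢a w≢a u≢w

does-≟-injective : ∀ {m} {σ : Fin n → Fin m} → Injective _≡_ _≡_ σ →
                   ∀ u w → does (σ u ≟ σ w) ≡ does (u ≟ w)
does-≟-injective {σ = σ} σ-inj u w with u ≟ w
... | yes refl = dec-true (σ u ≟ σ u) refl
... | no u≢w   = dec-false (σ u ≟ σ w) (u≢w ∘ σ-inj)

K₁∪K-adj-injective : ∀ {m} {σ : Fin n → Fin m} → Injective _≡_ _≡_ σ →
                     ∀ a u w → K₁∪K-adj (σ a) (σ u) (σ w) ≡ K₁∪K-adj a u w
K₁∪K-adj-injective σ-inj a u w
  rewrite does-≟-injective σ-inj u a | does-≟-injective σ-inj w a
        | does-≟-injective σ-inj u w = refl

transpose-sends : (a b : Fin n) → transpose a b ⟨$⟩ʳ a ≡ b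
transpose-sends a b rewrite dec-true (a ≟ a) refl = refl

IsK₁∪K-≅ : {G H : Graph n} {a b : Fin n} → IsK₁∪K G a → IsK₁∪K H b → G ≅ H
IsK₁∪K-≅ {G = G} {H} {a} {b} sG sH = record { bij = τ ; preserves = preserves }
  where
  open ≡-Reasoning
  τ = ↔⇒⤖ (transpose a b)
  σ = Bijection.to τ
  preserves : ∀ u w → adj G u w ≡ adj H (σ u) (σ w)
  preserves u w = begin
    adj G u w                       ≡⟨ adj-IsK₁∪K sG u w ⟩
    K₁∪K-adj a u w                  ≡⟨ K₁∪K-adj-injective (Bijection.injective τ) a u w ⟨
    K₁∪K-adj (σ a) (σ u) (σ w)      ≡⟨ cong (λ c → K₁∪K-adj c (σ u) (σ w)) (transpose-sends a b) ⟩
    K₁∪K-adj b (σ u) (σ w)          ≡⟨ adj-IsK₁∪K sH (σ u) (σ w) ⟨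
    adj H (σ u) (σ w)               ∎

SP-pairs-with-isolated : {G : Graph n} {v w : Fin n} → IsSP G → Isolated G v → w ≢ v →
                         Dominating G (⁅ w ⁆ ∪ ⁅ v ⁆)
SP-pairs-with-isolated {G = G} {v} {w} (_ , member) iso w≢v with member w
... | inj₁ (dom , _) = ⊥-elim (∉⁅⁆ (w≢v ∘ sym) (isolated-∈-dominating {G = G} iso dom))
... | inj₂ (_ , j , _ , _ , _ , _ , dom) with ∈-pair (isolated-∈-dominating {G = G} iso dom)
... | inj₁ v≡w = ⊥-elim (w≢v (sym v≡w))
... | inj₂ refl = dom

SP-isolated⇒IsK₁∪K : {G : Graph n} {v : Fin n} → IsSP G → Isolated G v → IsK₁∪K G v
SP-isolated⇒IsK₁∪K {G = G} {v} sp iso = record { isolated = iso ; clique = clique′ }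
  where
  clique′ : ∀ {w x} → w ≢ v → x ≢ v → w ≢ x → adj G w x ≡ true
  clique′ {w} {x} w≢v x≢v w≢x with SP-pairs-with-isolated {G = G} sp iso w≢v x
  ... | inj₁ x∈ = ⊥-elim (∉-pair (w≢x ∘ sym) x≢v x∈)
  ... | inj₂ (u , u∈ , u~x) with ∈-pair u∈
  ... | inj₁ refl = u~x
  ... | inj₂ refl = ⊥-elim (true≢false (trans (sym u~x) (iso x)))

module _ {G : Graph n} {a : Fin n} (s : IsK₁∪K G a) where

  IsK₁∪K-pair-dominating : ∀ {w} → w ≢ a → Dominating G (⁅ a ⁆ ∪ ⁅ w ⁆)
  IsK₁∪K-pair-dominating {w} w≢a x with x ≟ a | x ≟ w
  ... | yes refl | _        = inj₁ (∈-pairˡ a w)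
  ... | no _     | yes refl = inj₁ (∈-pairʳ a w)
  ... | no x≢a   | no x≢w   = inj₂ (w , ∈-pairʳ a w , clique s w≢a x≢a (x≢w ∘ sym))

  IsK₁∪K-coalition : ∀ {w} → w ≢ a → Coalition G ⁅ a ⁆ ⁅ w ⁆
  IsK₁∪K-coalition w≢a =
      ⁅⁆-disjoint (w≢a ∘ sym)
    , isolated-not-dominating {G = G} (isolated s) w≢a
    , (∉⁅⁆ (w≢a ∘ sym) ∘ isolated-∈-dominating {G = G} (isolated s))
    , IsK₁∪K-pair-dominating w≢a

  IsK₁∪K-no-coalition : ∀ {u w} → u ≢ a → w ≢ a → ¬ Coalition G ⁅ u ⁆ ⁅ w ⁆
  IsK₁∪K-no-coalition u≢a w≢a (_ , _ , _ , dom) =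
    ∉-pair (u≢a ∘ sym) (w≢a ∘ sym) (isolated-∈-dominating {G = G} (isolated s) dom)

IsK₁∪K-isSP : {G : Graph n} {a w : Fin n} → IsK₁∪K G a → w ≢ a → IsSP G
IsK₁∪K-isSP {n} {G} {a} {w} s w≢a = Γ₁-isPartition n , member
  where
  member : ∀ i → SingletonMember G i
  member i with i ≟ a
  ... | yes refl = inj₂ (coalition-¬dominatingˡ {G = G} coalition , w , w≢a , coalition)
    where coalition = IsK₁∪K-coalition s w≢a
  ... | no i≢a   = inj₂ (coalition-¬dominatingˡ {G = G} coalition , a , (i≢a ∘ sym) , coalition)
    where coalition = coalition-sym G _ _ (IsK₁∪K-coalition s i≢a)

K₁∪K-IsK₁∪K : ∀ m → IsK₁∪K (K₁∪K m) zero
K₁∪K-IsK₁∪K m = record { isolated = λ _ → refl ; clique = clique′ }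
  where
  clique′ : ∀ {u w : Fin (suc m)} → u ≢ zero → w ≢ zero → u ≢ w → adj (K₁∪K m) u w ≡ true
  clique′ {zero}  u≢0 _   _   = ⊥-elim (u≢0 refl)
  clique′ {suc _} {zero} _ w≢0 _ = ⊥-elim (w≢0 refl)
  clique′ {suc i} {suc j} _ _ i≢j = cong not (dec-false (i ≟ j) (i≢j ∘ cong suc))

CG₁-K₁∪K≅Star : ∀ k → CG₁ (K₁∪K (suc k)) ≅ Star (suc k)
CG₁-K₁∪K≅Star k = record { bij = ⤖-id _ ; preserves = preserves }
  where
  K = K₁∪K (suc k)
  s = K₁∪K-IsK₁∪K (suc k)
  preserves : ∀ u w → adj (CG₁ K) u w ≡ adj (Star (suc k)) u w
  preserves zero    zero    = adj-irrefl (CG₁ K) zero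
  preserves zero    (suc b) =
    dec-true (coalition? K ⁅ zero ⁆ ⁅ suc b ⁆) (IsK₁∪K-coalition s {suc b} (λ ()))
  preserves (suc a) zero    =
    dec-true (coalition? K ⁅ suc a ⁆ ⁅ zero ⁆)
             (coalition-sym K _ _ (IsK₁∪K-coalition s {suc a} (λ ())))
  preserves (suc a) (suc b) =
    dec-false (coalition? K ⁅ suc a ⁆ ⁅ suc b ⁆)
              (IsK₁∪K-no-coalition s {suc a} {suc b} (λ ()) (λ ()))

Star-centre-full : ∀ m → Full (Star m) zero
Star-centre-full m zero    0≢0 = ⊥-elim (0≢0 refl)
Star-centre-full m (suc _) _   = refl

Star-centre-dominating : ∀ m → Dominating (Star m) ⁅ zero ⁆
Star-centre-dominating m zero    = inj₁ (x∈⁅x⁆ zero)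
Star-centre-dominating m (suc _) = inj₂ (zero , x∈⁅x⁆ zero , refl)

Star-leaves-∈-dominating : ∀ {m} {D : Subset (suc m)} → zero ∉ D → Dominating (Star m) D →
                           ∀ c → suc c ∈ D
Star-leaves-∈-dominating 0∉D dom c with dom (suc c)
... | inj₁ c∈D              = c∈D
... | inj₂ (zero , 0∈D , _) = ⊥-elim (0∉D 0∈D)

third-leaf : ∀ {k} (j : Fin (3 + k)) → ∃ λ c → c ≢ zero × c ≢ j
third-leaf zero             = suc zero , (λ ()) , (λ ())
third-leaf (suc zero)       = suc (suc zero) , (λ ()) , (λ ())
third-leaf (suc (suc _))    = suc zero , (λ ()) , (λ ())

Star-two-leaves-not-dominating : ∀ k (j : Fin (3 + k)) →
                                 ¬ Dominating (Star (3 + k)) (⁅ suc zero ⁆ ∪ ⁅ suc j ⁆)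
Star-two-leaves-not-dominating k j dom with third-leaf j
... | c , c≢0 , c≢j =
  ∉-pair (c≢0 ∘ suc-injective) (c≢j ∘ suc-injective)
         (Star-leaves-∈-dominating (∉-pair {a = suc zero} {suc j} (λ ()) (λ ())) dom c)

Star-not-SP : ∀ k → ¬ IsSP (Star (3 + k))
Star-not-SP k (_ , member) with member (suc zero)
... | inj₁ (dom , _) =
  Star-two-leaves-not-dominating k zero
    (Dominating-mono {G = Star (3 + k)} (p⊆p∪q ⁅ suc zero ⁆) dom)
... | inj₂ (_ , zero , _ , _ , _ , centre-not-dominating , _) =
  centre-not-dominating (Star-centre-dominating (3 + k))
... | inj₂ (_ , suc j , _ , _ , _ , _ , dom) = Star-two-leaves-not-dominating k j dom

singletonMember? : (G : Graph n) (i : Fin n) → Dec (SingletonMember G i)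
singletonMember? G i = (dominating? G ⁅ i ⁆ ×-dec (∣ ⁅ i ⁆ ∣ ℕ.≟ 1))
  ⊎-dec (¬? (dominating? G ⁅ i ⁆) ×-dec any? λ j → ¬? (j ≟ i) ×-dec coalition? G ⁅ i ⁆ ⁅ j ⁆)

isSP-by-decision : (G : Graph n) → {True (all? (singletonMember? G))} → IsSP G
isSP-by-decision {n} G {ok} = Γ₁-isPartition n , toWitness ok

K₁-IsK₁∪K : IsK₁∪K K₁ zero
K₁-IsK₁∪K = record { isolated = λ _ → refl ; clique = λ { {zero} 0≢0 _ _ → ⊥-elim (0≢0 refl) } }

K̄₂-IsK₁∪K : IsK₁∪K K̄₂ zero
K̄₂-IsK₁∪K = record { isolated = λ _ → refl ; clique = clique′ }
  where
  clique′ : ∀ {u w : Fin 2} → u ≢ zero → w ≢ zero → u ≢ w → adj K̄₂ u w ≡ true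
  clique′ {zero}     0≢0 _   _   = ⊥-elim (0≢0 refl)
  clique′ {suc zero} {zero}     _ 0≢0 _   = ⊥-elim (0≢0 refl)
  clique′ {suc zero} {suc zero} _ _   1≢1 = ⊥-elim (1≢1 refl)

K₁-step : Step K₁ K₁
K₁-step = isSP-by-decision K₁ , ≅-by-relabelling (CG₁ K₁) K₁ (⤖-id _)

K̄₂-step : Step K̄₂ K₂
K̄₂-step = isSP-by-decision K̄₂ , ≅-by-relabelling (CG₁ K̄₂) K₂ (⤖-id _)

K₂-step : Step K₂ K̄₂
K₂-step = isSP-by-decision K₂ , ≅-by-relabelling (CG₁ K₂) K̄₂ (⤖-id _)

K₁∪K₂-step : Step K₁∪K₂ P₃
K₁∪K₂-step =
  isSP-by-decision K₁∪K₂ , ≅-by-relabelling (CG₁ K₁∪K₂) P₃ (↔⇒⤖ (transpose zero (suc zero)))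

P₃-step : Step P₃ K₁∪K₂
P₃-step =
  isSP-by-decision P₃ , ≅-by-relabelling (CG₁ P₃) K₁∪K₂ (↔⇒⤖ (transpose zero (suc zero)))

K₂≇K̄₂ : ¬ K₂ ≅ K̄₂
K₂≇K̄₂ =
  full-≇-isolated {c = zero} {y = suc zero} {z = zero} full (λ ()) (isolated K̄₂-IsK₁∪K)
  where
  full : Full K₂ zero
  full zero       0≢0 = ⊥-elim (0≢0 refl)
  full (suc zero) _   = refl

P₃≇K₁∪K₂ : ¬ P₃ ≅ K₁∪K₂
P₃≇K₁∪K₂ =
  full-≇-isolated {c = suc zero} {y = zero} {z = zero} full (λ ()) (isolated (K₁∪K-IsK₁∪K 2))
  where
  full : Full P₃ (suc zero)
  full zero             _   = refl
  full (suc zero)       1≢1 = ⊥-elim (1≢1 refl)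
  full (suc (suc zero)) _   = refl

alternate-InfChain : {G A B : Graph n} → A ≅ G → Step A B → Step B A → InfChain G (alternate A B)
alternate-InfChain {A = A} {B} A≅G A→B B→A = A≅G , steps
  where
  steps : ∀ i → Step (alternate A B i) (alternate A B (suc i))
  steps zero          = A→B
  steps (suc zero)    = B→A
  steps (suc (suc i)) = steps i

two-periodic-chain : {G A B : Graph n} {v a : Fin n} → IsK₁∪K G v → IsK₁∪K A a →
                     Step A B → Step B A → ¬ B ≅ A →
                     G ≅ A × LSCC G ∞ × ∃[ g ] (InfChain G g × (∀ i → g i ≅ alternate A B i))
two-periodic-chain {A = A} {B} sG sA A→B B→A B≇A =
  IsK₁∪K-≅ sG sA , inf-chain g chain (λ all≅ → B≇A (all≅ 1)) , g , chain , λ _ → ≅-refl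
  where
  g = alternate A B
  chain = alternate-InfChain (IsK₁∪K-≅ sA sG) A→B B→A

chain-order-1 : ∀ m {G : Graph (suc m)} {v} → IsK₁∪K G v → suc m ≡ 1 →
          G ≅ K₁ × LSCC G (fin 0) × ∃[ g ] (InfChain G g × (∀ i → g i ≅ K₁))
chain-order-1 zero s refl =
  IsK₁∪K-≅ s K₁-IsK₁∪K , inf-const g chain (λ _ → ≅-refl) , g , chain , λ _ → ≅-refl
  where
  g = λ _ → K₁
  chain = IsK₁∪K-≅ K₁-IsK₁∪K s , λ _ → K₁-step

chain-order-2 : ∀ m {G : Graph (suc m)} {v} → IsK₁∪K G v → suc m ≡ 2 →
          G ≅ K̄₂ × LSCC G ∞ × ∃[ g ] (InfChain G g × (∀ i → g i ≅ alternate K̄₂ K₂ i))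
chain-order-2 (suc zero) s refl = two-periodic-chain s K̄₂-IsK₁∪K K̄₂-step K₂-step K₂≇K̄₂

chain-order-3 : ∀ m {G : Graph (suc m)} {v} → IsK₁∪K G v → suc m ≡ 3 →
          G ≅ K₁∪K₂ × LSCC G ∞ × ∃[ g ] (InfChain G g × (∀ i → g i ≅ alternate K₁∪K₂ P₃ i))
chain-order-3 (suc (suc zero)) s refl =
  two-periodic-chain s (K₁∪K-IsK₁∪K 2) K₁∪K₂-step P₃-step P₃≇K₁∪K₂

chain-order-≥4 : ∀ m {G : Graph (suc m)} {v} → IsK₁∪K G v → 3 < suc m →
           G ≅ K₁∪K m × LSCC G (fin 1) × ∃[ g ] (FinChain G 1 g × g 1 ≅ Star m)
chain-order-≥4 (suc (suc (suc k))) s (s≤s (s≤s (s≤s (s≤s _)))) =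
  IsK₁∪K-≅ s K-shape , fin-chain g chain (λ all≅ → Star≇K (all≅ 1 (s≤s z≤n))) , g , chain , ≅-refl
  where
  K = K₁∪K (3 + k)
  K-shape = K₁∪K-IsK₁∪K (3 + k)
  g : ℕ → Graph (4 + k)
  g zero    = K
  g (suc _) = Star (3 + k)
  chain : FinChain _ 1 g
  chain = IsK₁∪K-≅ K-shape s
        , (λ { zero _ → IsK₁∪K-isSP {w = suc zero} K-shape (λ ()) , CG₁-K₁∪K≅Star (2 + k)
            ; (suc _) (s≤s ()) })
        , Star-not-SP k
  Star≇K : ¬ Star (3 + k) ≅ K
  Star≇K = full-≇-isolated {c = zero} {y = suc zero} {z = zero}
             (Star-centre-full _) (λ ()) (isolated K-shape)

theorem8 : ∀ (m : ℕ) (G : Graph (suc m)) → IsSP G → δ G ≡ 0 →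
    (suc m ≡ 1 → G ≅ K₁ × LSCC G (fin 0)
        × ∃[ g ] (InfChain G g × (∀ i → g i ≅ K₁)))
    × (suc m ≡ 2 → G ≅ K̄₂ × LSCC G ∞
        × ∃[ g ] (InfChain G g × (∀ i → g i ≅ alternate K̄₂ K₂ i)))
    × (3 < suc m → G ≅ K₁∪K m × LSCC G (fin 1)
        × ∃[ g ] (FinChain G 1 g × g 1 ≅ Star m))
    × (suc m ≡ 3 → G ≅ K₁∪K₂ × LSCC G ∞
        × ∃[ g ] (InfChain G g × (∀ i → g i ≅ alternate K₁∪K₂ P₃ i)))
theorem8 m G sp δ≡0 =
  chain-order-1 m shape , chain-order-2 m shape , chain-order-≥4 m shape , chain-order-3 m shape
  where
  shape : IsK₁∪K G (proj₁ (δ≡0⇒isolated G δ≡0))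
  shape = SP-isolated⇒IsK₁∪K sp (proj₂ (δ≡0⇒isolated G δ≡0))
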